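{- Let $U^2=UU$ be a fragment (occurrence of a square) of a string $T$. Then $U^2$ is a special square if and only if there exist neighboring runs $F,F'$ of $T$ with the same period and equal Lyndon roots and a layer $R$ of the pyramid $\mathbf{P}(F,F')$ such that $U^2\in\mathrm{frag\text{ - }squares}(R\cap(F\cup F'))$ and $\mathrm{per}(U)=\mathrm{per}(F)$.
   Context: Strings are 0-indexed; $T[i\,..\,j]$ is a fragment. A positive integer $r\le|S|$ is a period of $S$ if $S[i]=S[i+r]$ for all valid $i$; $\mathrm{per}(S)$ is the smallest period; $S$ is periodic if $\mathrm{per}(S)\le|S|/2$. A non-empty string $S$ is primitive if $S=V^t$ with $t$ a positive integer implies $t=1$. A square $X^2$ is special if $X$ is primitive and $\mathrm{per}(X)\le |X|/4$ (i.e., it is primitively rooted and subperiodic). A run of $T$ is a periodic fragment $T[a\,..\,b]$ with $r=\mathrm{per}(T[a\,..\,b])$ such that ($a=0$ or $T[a-1]\ne T[a-1+r]$) and ($b=|T|-1$ or $T[b+1]\ne T[b+1-r]$). The Lyndon root of a periodic string $S$ is the lexicographically smallest rotation of $S[0\,..\,\mathrm{per}(S))$. Fragments $T[a\,..\,b]$, $T[a'\,..\,b']$ are neighboring if $[a-1\,..\,b+1]\cap[a'\,..\,b']\ne\emptyset$; then $F\cup F'=T[\min(a,a')\,..\,\max(b,b')]$ and $F\cap F'=T[\max(a,a')\,..\,\min(b,b')]$. A square $X^2$ is generated by a periodic fragment $V$ if $X^2$ is a fragment contained in $V$ with $\mathrm{per}(X^2)=\mathrm{per}(V)$; $\mathrm{frag\text{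 - }squares}(V)$ is the set of these. $\mathrm{subper}(V)=\min\{\mathrm{per}(X):X^2\in\mathrm{frag\text{ - }squares}(V)\}$; $V$ is subperiodic if $\mathrm{subper}(V)\le\mathrm{per}(V)/4$. For neighboring runs $F,F'$ with the same period $p$ and equal Lyndon roots, the pyramid $\mathbf{P}(F,F')$ is the set of subperiodic runs $R$ of $T$ with $\mathrm{subper}(R)=p$ such that $R\cap(F\cup F')$ is periodic with period $\mathrm{per}(R)$; its elements are layers. -}

module Defs where

open import Data.Nat using (ℕ; zero; suc; _+_; _*_; _∸_; _≤_; _<_; _⊔_; _⊓_)
open import Data.List using (List; []; _∷_; length; take; drop; _++_; concat; replicate)
open import Data.Maybe using (Maybe; just; nothing)
open import Data.Product using (Σ; ∃; ∃-syntax; _×_; _,_)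
open import Data.Sum using (_⊎_)
open import Relation.Binary.PropositionalEquality using (_≡_; _≢_)
open import Relation.Binary.Core using (Rel)
open import Level using (0ℓ)
open import Data.List.Relation.Binary.Lex.Strict using (Lex-≤)

-- Strings are lists; positions are 0-indexed.
-- at S i = just (S[i]) if i < |S|, nothing otherwise.
at : {A : Set} → List A → ℕ → Maybe A
at []       _       = nothing
at (x ∷ xs) zero    = just x
at (x ∷ xs) (suc i) = at xs i

-- The fragment T[a .. b] (empty if b < a).
frag : {A : Set} → List A → ℕ → ℕ → List A
frag T a b = take (suc b ∸ a) (drop a T)

-- T[a..b] and T[a'..b'] are neighboring: [a-1..b+1] ∩ [a'..b'] ≠ ∅
Neighboring : ℕ → ℕ → ℕ → ℕ → Set
Neighboring a b a' b' = ∃[ i ] (a ≤ suc i × i ≤ suc b × a' ≤ i × i ≤ b')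

module _ {A : Set} where

  IsPeriod : List A → ℕ → Set
  IsPeriod S r = (1 ≤ r) × (r ≤ length S) ×
                 (∀ i → i + r < length S → at S i ≡ at S (i + r))

  Per : List A → ℕ → Set
  Per S p = IsPeriod S p × (∀ q → IsPeriod S q → p ≤ q)

  Periodic : List A → Set
  Periodic S = ∃[ p ] (Per S p × 2 * p ≤ length S)

  Primitive : List A → Set
  Primitive S = (S ≢ []) × (∀ (V : List A) (t : ℕ) → 1 ≤ t → S ≡ concat (replicate t V) → t ≡ 1)

  -- X^2 is a special square: X primitive and per(X) ≤ |X|/4
  SpecialSquare : List A → Set
  SpecialSquare X = Primitive X × ∃[ p ] (Per X p × 4 * p ≤ length X)

  IsRotation : List A → List A → Set
  IsRotation W L = ∃[ j ] (j ≤ length W × L ≡ drop j W ++ take j W)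

  LyndonRoot : Rel A 0ℓ → List A → List A → Set
  LyndonRoot _≺_ S L =
    Periodic S × ∃[ p ] (Per S p × IsRotation (take p S) L ×
      (∀ L' → IsRotation (take p S) L' → Lex-≤ _≡_ _≺_ L L'))

  -- Notions about fragments of a fixed text T; a fragment T[a..b] is
  -- given by its endpoints a, b.

  IsFragment : List A → ℕ → ℕ → Set
  IsFragment T a b = (a ≤ b) × (b < length T)

  IsRun : List A → ℕ → ℕ → Set
  IsRun T a b = IsFragment T a b × Periodic (frag T a b) ×
    ∃[ r ] (Per (frag T a b) r ×
      (a ≡ 0 ⊎ at T (a ∸ 1) ≢ at T (a ∸ 1 + r)) ×
      (suc b ≡ length T ⊎ at T (suc b) ≢ at T (suc b ∸ r)))

  -- The square fragment X^2 = T[s .. s+2k-1] (X = T[s..s+k-1], |X| = k ≥ 1)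
  IsSquareAt : List A → ℕ → ℕ → Set
  IsSquareAt T s k = (1 ≤ k) × (s + 2 * k ≤ length T) ×
    (frag T s (s + k ∸ 1) ≡ frag T (s + k) (s + 2 * k ∸ 1))

  InFragSquares : List A → ℕ → ℕ → ℕ → ℕ → Set
  InFragSquares T s k c d = IsSquareAt T s k × c ≤ s × s + 2 * k ∸ 1 ≤ d ×
    ∃[ p ] (Per (frag T s (s + 2 * k ∸ 1)) p × Per (frag T c d) p)

  SubPer : List A → ℕ → ℕ → ℕ → Set
  SubPer T c d q =
    (∃[ s ] ∃[ k ] (InFragSquares T s k c d × Per (frag T s (s + k ∸ 1)) q)) ×
    (∀ s k q' → InFragSquares T s k c d → Per (frag T s (s + k ∸ 1)) q' → q ≤ q')

  Subperiodic : List A → ℕ → ℕ → Set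
  Subperiodic T c d = ∃[ q ] ∃[ r ] (SubPer T c d q × Per (frag T c d) r × 4 * q ≤ r)

  -- R = T[c..d] is a layer of the pyramid P(F,F'), F = T[a..b], F' = T[a'..b'],
  -- where p is the common period of F and F'.
  -- R ∩ (F ∪ F') = T[max(c, min(a,a')) .. min(d, max(b,b'))].
  IsLayer : List A → ℕ → ℕ → ℕ → ℕ → ℕ → ℕ → ℕ → Set
  IsLayer T p a b a' b' c d =
    IsRun T c d × Subperiodic T c d × SubPer T c d p ×
    Periodic (frag T (c ⊔ (a ⊓ a')) (d ⊓ (b ⊔ b'))) ×
    ∃[ r ] (Per (frag T c d) r × Per (frag T (c ⊔ (a ⊓ a')) (d ⊓ (b ⊔ b'))) r)

module Submission where

-- Let U have length k, per(U) = p and 4p ≤ k. If U is primitive, per(UU) = k: a shorter period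
-- would, with the period k, yield by Fine–Wilf a common divisor g of k that is a period of U, and U
-- would be a proper power of its prefix of length g. Extending the two copies of U with period p
-- gives neighbouring runs F, F'; as U has length ≥ 2p, the rotations of the period of F, of F' and
-- of U are the length-p factors of U, so all three share their Lyndon root. Extending UU with
-- period k gives a run R with R ∩ (F ∪ F') ⊇ UU of period k. R is a layer with subper(R) = p:
-- a square X² generated by R has per(X²) = k ≤ |X|, so X contains a length-k window of R, which
-- by k-periodicity equals a window of UU starting in the first copy; that window shares ≥ 2p
-- letters with a copy of U, where by Fine–Wilf no period shorter than p is possible.
-- Conversely, the layer gives per(UU) = per(R) ≥ 4 subper(R) = 4p. If per(UU) < k then
-- per(UU) = per(U) = p (both periods spread over UU), which is absurd; so per(UU) = k, which
-- forces U to be primitive, and 4p ≤ k.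

open import Defs
open import Data.Nat
open import Data.Nat.Properties
open import Data.Nat.Divisibility using (_∣_; divides; ∣-refl; ∣m∣n⇒∣m+n; ∣⇒≤)
open import Data.Nat.Tactic.RingSolver using (solve)
open import Data.List using (List; []; _∷_; length; take; drop; _++_; concat; replicate)
open import Data.List.Properties
  using (length-take; length-drop; length-++; take-all; take-[]; take-take; take-drop; drop-drop; take++drop≡id; ++-identityʳ; ++-assoc)
import Data.List.Relation.Binary.Lex.Strict as Lex
open Lex using (Lex-≤)
open import Data.Maybe using (Maybe; nothing)
open import Data.Maybe.Properties using (≡-dec)
open import Data.Sum using (_⊎_; inj₁; inj₂)
open import Data.Product using (∃; ∃-syntax; _×_; _,_; proj₁; proj₂)
open import Data.Empty using (⊥-elim)
open import Function using (case_of_)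
open import Function.Bundles using (_⇔_; mk⇔; Equivalence)
open import Level using (0ℓ)
open import Relation.Nullary using (yes; no)
open import Relation.Binary.Core using (Rel)
open import Relation.Binary.Definitions using (DecidableEquality; tri<; tri≈; tri>)
open import Relation.Binary.Structures using (IsStrictTotalOrder; IsTotalOrder)
open import Relation.Binary.PropositionalEquality
open ≡-Reasoning

m<m+n⇒0<n : ∀ m n → m < m + n → 0 < n
m<m+n⇒0<n m zero    m<m+0 = ⊥-elim (<-irrefl (sym (+-identityʳ m)) m<m+0)
m<m+n⇒0<n m (suc n) _     = s≤s z≤n

4*n≡2n+2n : ∀ n → 4 * n ≡ (n + n) + (n + n)
4*n≡2n+2n n = solve (n ∷ [])

≤suc⇒pred-≤ : ∀ m {n} → m ≤ suc n → m ∸ 1 ≤ n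
≤suc⇒pred-≤ zero    _         = z≤n
≤suc⇒pred-≤ (suc m) (s≤s m≤n) = m≤n

pred-≤⇒≤suc : ∀ m {n} → m ∸ 1 ≤ n → m ≤ suc n
pred-≤⇒≤suc zero    _   = z≤n
pred-≤⇒≤suc (suc m) m≤n = s≤s m≤n

-- Periods of a sequence on a window of indices

PeriodOn : {B : Set} → (ℕ → B) → ℕ → ℕ → ℕ → Set
PeriodOn f lo hi r = ∀ i → lo ≤ i → i + r < hi → f i ≡ f (i + r)

SameWindow : {B : Set} → (ℕ → B) → ℕ → ℕ → ℕ → Set
SameWindow f m x y = ∀ i → i < m → f (x + i) ≡ f (y + i)

module _ {B : Set} (f : ℕ → B) where

  periodOn-restrict : ∀ {lo hi lo' hi' r} → PeriodOn f lo hi r → lo ≤ lo' → hi' ≤ hi →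
                      PeriodOn f lo' hi' r
  periodOn-restrict P lo≤lo' hi'≤hi i lo'≤i lt = P i (≤-trans lo≤lo' lo'≤i) (<-≤-trans lt hi'≤hi)

  periodOn-difference : ∀ {lo hi} p d → PeriodOn f lo hi p → PeriodOn f lo hi (p + d) →
                        lo + (p + (p + d)) ≤ hi → PeriodOn f lo hi d
  periodOn-difference {lo} {hi} p d Pp Ppd H i lo≤i i+d<hi with i + (p + d) <? hi
  ... | yes fits = begin
    f i             ≡⟨ Ppd i lo≤i fits ⟩
    f (i + (p + d)) ≡⟨ cong f reorder ⟩
    f (i + d + p)   ≡⟨ Pp (i + d) (≤-trans lo≤i (m≤m+n i d)) (subst (_< hi) reorder fits) ⟨
    f (i + d)       ∎
    where
      reorder : i + (p + d) ≡ i + d + p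
      reorder = solve (i ∷ p ∷ d ∷ [])
  ... | no overflows with m≤n⇒∃[o]m+o≡n lo+p≤i
    where
      lo+p≤i : lo + p ≤ i
      lo+p≤i = +-cancelʳ-≤ (p + d) (lo + p) i
                 (≤-trans (≤-reflexive (+-assoc lo p (p + d))) (≤-trans H (≮⇒≥ overflows)))
  ... | e , refl = begin
    f (lo + p + e)       ≡⟨ cong f (solve (lo ∷ p ∷ e ∷ [])) ⟩
    f (lo + e + p)       ≡⟨ Pp (lo + e) (m≤m+n lo e) (≤-<-trans (+-monoʳ-≤ (lo + e) (m≤m+n p d)) lt) ⟨
    f (lo + e)           ≡⟨ Ppd (lo + e) (m≤m+n lo e) lt ⟩
    f (lo + e + (p + d)) ≡⟨ cong f reorder ⟨
    f (lo + p + e + d)   ∎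
    where
      reorder : lo + p + e + d ≡ lo + e + (p + d)
      reorder = solve (lo ∷ p ∷ e ∷ d ∷ [])
      lt : lo + e + (p + d) < hi
      lt = subst (_< hi) reorder i+d<hi

  CommonDivisorPeriod : ℕ → ℕ → ℕ → ℕ → Set
  CommonDivisorPeriod lo hi p q = ∃ λ g → 1 ≤ g × g ∣ p × g ∣ q × PeriodOn f lo hi g

  private
    swap-divisors : ∀ {lo hi p q} → CommonDivisorPeriod lo hi p q → CommonDivisorPeriod lo hi q p
    swap-divisors (g , 1≤g , g∣p , g∣q , Pg) = g , 1≤g , g∣q , g∣p , Pg

    -- Euclid's subtractive algorithm; the fuel n bounds p + q.
    mutual
      euclid : ∀ {lo hi} n p q → p + q ≤ n → 1 ≤ p → 1 ≤ q →
               PeriodOn f lo hi p → PeriodOn f lo hi q → lo + (p + q) ≤ hi → CommonDivisorPeriod lo hi p q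
      euclid zero    (suc p) q () _ _ _ _ _
      euclid {lo} {hi} (suc n) p q fuel 1≤p 1≤q Pp Pq H with <-cmp p q
      ... | tri≈ _ refl _ = p , 1≤p , ∣-refl , ∣-refl , Pp
      ... | tri< p<q _ _  = euclid-< n p q fuel 1≤p Pp Pq H p<q
      ... | tri> _ _ q<p  = swap-divisors (euclid-< n q p (subst (_≤ suc n) (+-comm p q) fuel) 1≤q Pq Pp
                                             (subst (λ x → lo + x ≤ hi) (+-comm p q) H) q<p)

      euclid-< : ∀ {lo hi} n p q → p + q ≤ suc n → 1 ≤ p →
                 PeriodOn f lo hi p → PeriodOn f lo hi q → lo + (p + q) ≤ hi → p < q → CommonDivisorPeriod lo hi p q
      euclid-< {lo} n p q fuel 1≤p Pp Pq H p<q with m≤n⇒∃[o]m+o≡n (<⇒≤ p<q)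
      ... | d , refl with euclid n p d (s≤s⁻¹ (≤-trans (+-monoˡ-≤ (p + d) 1≤p) fuel)) 1≤p (m<m+n⇒0<n p d p<q)
                             Pp (periodOn-difference p d Pp Pq H)
                             (≤-trans (+-monoʳ-≤ lo (+-monoʳ-≤ p (m≤n+m d p))) H)
      ... | g , 1≤g , g∣p , g∣d , Pg = g , 1≤g , g∣p , ∣m∣n⇒∣m+n g∣p g∣d , Pg

  fine-wilf : ∀ {lo hi} p q → 1 ≤ p → 1 ≤ q → PeriodOn f lo hi p → PeriodOn f lo hi q →
              lo + (p + q) ≤ hi → CommonDivisorPeriod lo hi p q
  fine-wilf p q = euclid (p + q) p q ≤-refl

  sameWindow-trans : ∀ {m x y z} → SameWindow f m x y → SameWindow f m y z → SameWindow f m x z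
  sameWindow-trans E E' i i<m = trans (E i i<m) (E' i i<m)

  sameWindow-sym : ∀ {m x y} → SameWindow f m x y → SameWindow f m y x
  sameWindow-sym E i i<m = sym (E i i<m)

  periodOn-shift : ∀ {lo hi p m x} → PeriodOn f lo hi p → lo ≤ x → x + p + m ≤ hi → SameWindow f m x (x + p)
  periodOn-shift {lo} {hi} {p} {m} {x} P lo≤x bound i i<m = begin
    f (x + i)     ≡⟨ P (x + i) (≤-trans lo≤x (m≤m+n x i)) (subst (_< hi) (sym reorder) (<-≤-trans (+-monoʳ-< (x + p) i<m) bound)) ⟩
    f (x + i + p) ≡⟨ cong f reorder ⟩
    f (x + p + i) ∎
    where
      reorder : x + i + p ≡ x + p + i
      reorder = solve (x ∷ i ∷ p ∷ [])

  periodOn-transport : ∀ {n x y v r} → SameWindow f n x y → v ≤ n → PeriodOn f x (x + v) r → PeriodOn f y (y + v) r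
  periodOn-transport {n} {x} {y} {v} {r} E v≤n P i y≤i lt with m≤n⇒∃[o]m+o≡n y≤i
  ... | t , refl = begin
    f (y + t)       ≡⟨ E t t<n ⟨
    f (x + t)       ≡⟨ P (x + t) (m≤m+n x t) (subst (_< x + v) (sym (+-assoc x t r)) (+-monoʳ-< x t+r<v)) ⟩
    f (x + t + r)   ≡⟨ cong f (+-assoc x t r) ⟩
    f (x + (t + r)) ≡⟨ E (t + r) (<-≤-trans t+r<v v≤n) ⟩
    f (y + (t + r)) ≡⟨ cong f (+-assoc y t r) ⟨
    f (y + t + r)   ∎
    where
      t+r<v : t + r < v
      t+r<v = +-cancelˡ-< y (t + r) v (subst (_< y + v) (+-assoc y t r) lt)
      t<n : t < n
      t<n = ≤-<-trans (m≤m+n t r) (<-≤-trans t+r<v v≤n)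

  module _ {lo hi p m y} (P : PeriodOn f lo hi p) (1≤p : 1 ≤ p) (lo≤y : lo ≤ y) (bound : y + p + m ≤ hi) where

    Represented : ℕ → Set
    Represented x = ∃ λ x' → y ≤ x' × x' < y + p × SameWindow f m x x'

    private
      fromAbove : ∀ n x → y ≤ x → x < y + p + n → x + m ≤ hi → Represented x
      fromAbove n x y≤x x<y+p+n x+m≤hi with x <? y + p
      ... | yes x<y+p = x , y≤x , x<y+p , λ _ _ → refl
      fromAbove zero x y≤x x<y+p+0 x+m≤hi | no x≮y+p =
        ⊥-elim (x≮y+p (subst (x <_) (+-identityʳ (y + p)) x<y+p+0))
      fromAbove (suc n) x y≤x x<y+p+1+n x+m≤hi | no x≮y+p with m≤n⇒∃[o]m+o≡n (≮⇒≥ x≮y+p)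
      ... | e , refl = step (fromAbove n (y + e) (m≤m+n y e) below (≤-trans (+-monoˡ-≤ m (m≤m+n (y + e) p)) fits))
        where
          reorder : y + e + p ≡ y + p + e
          reorder = solve (y ∷ e ∷ p ∷ [])
          fits : y + e + p + m ≤ hi
          fits = subst (λ z → z + m ≤ hi) (sym reorder) x+m≤hi
          below : y + e < y + p + n
          below = <-≤-trans (+-monoʳ-< y (+-cancelˡ-< (y + p) e (suc n) x<y+p+1+n))
                    (≤-trans (≤-reflexive (sym (+-assoc y 1 n))) (+-monoˡ-≤ n (+-monoʳ-≤ y 1≤p)))
          shifted : SameWindow f m (y + p + e) (y + e)
          shifted = subst (λ z → SameWindow f m z (y + e)) reorder
                      (sameWindow-sym (periodOn-shift P (≤-trans lo≤y (m≤m+n y e)) fits))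
          step : Represented (y + e) → Represented (y + p + e)
          step (x' , y≤x' , x'<y+p , same) = x' , y≤x' , x'<y+p , sameWindow-trans shifted same

      fromBelow : ∀ n x → y ≤ x + n → lo ≤ x → x + m ≤ hi → Represented x
      fromBelow n x y≤x+n lo≤x x+m≤hi with y ≤? x
      ... | yes y≤x = fromAbove x x y≤x (≤-<-trans (m≤n+m x y) (+-monoˡ-< x (m<m+n y 1≤p))) x+m≤hi
      fromBelow zero x y≤x+0 lo≤x x+m≤hi | no y≰x = ⊥-elim (y≰x (subst (y ≤_) (+-identityʳ x) y≤x+0))
      fromBelow (suc n) x y≤x+1+n lo≤x x+m≤hi | no y≰x =
        step (fromBelow n (x + p) y≤x+p+n (≤-trans lo≤x (m≤m+n x p)) fits)
        where
          y≤x+p+n : y ≤ x + p + n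
          y≤x+p+n = ≤-trans y≤x+1+n (≤-trans (≤-reflexive (sym (+-assoc x 1 n))) (+-monoˡ-≤ n (+-monoʳ-≤ x 1≤p)))
          fits : x + p + m ≤ hi
          fits = ≤-trans (+-monoˡ-≤ m (+-monoˡ-≤ p (<⇒≤ (≰⇒> y≰x)))) bound
          step : Represented (x + p) → Represented x
          step (x' , y≤x' , x'<y+p , same) = x' , y≤x' , x'<y+p , sameWindow-trans (periodOn-shift P lo≤x fits) same

    periodOn-representative : ∀ x → lo ≤ x → x + m ≤ hi → Represented x
    periodOn-representative x = fromBelow y x (m≤n+m y x)

  periodOn-propagate : ∀ {lo hi p g w} → PeriodOn f lo hi p → 1 ≤ p → lo ≤ w → w + p + g < hi →
                       PeriodOn f w (w + p + g) g → PeriodOn f lo hi g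
  periodOn-propagate {lo} {hi} {p} {g} {w} Pp 1≤p lo≤w bound Pg i lo≤i i+g<hi
    with periodOn-representative Pp 1≤p lo≤w (subst (_≤ hi) (sym (+-suc (w + p) g)) bound) i lo≤i
                                 (subst (_≤ hi) (sym (+-suc i g)) i+g<hi)
  ... | x' , w≤x' , x'<w+p , same = begin
    f i          ≡⟨ cong f (+-identityʳ i) ⟨
    f (i + 0)    ≡⟨ same 0 (s≤s z≤n) ⟩
    f (x' + 0)   ≡⟨ cong f (+-identityʳ x') ⟩
    f x'         ≡⟨ Pg x' w≤x' (+-monoˡ-< g x'<w+p) ⟩
    f (x' + g)   ≡⟨ same g ≤-refl ⟨
    f (i + g)    ∎

  periodOn-agree : ∀ {g : ℕ → B} {lo hi r} → (∀ i → lo ≤ i → i < hi → f i ≡ g i) →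
                   PeriodOn f lo hi r → PeriodOn g lo hi r
  periodOn-agree {g} {r = r} f≗g P i lo≤i i+r<hi =
    trans (sym (f≗g i lo≤i (≤-<-trans (m≤m+n i r) i+r<hi)))
          (trans (P i lo≤i i+r<hi) (f≗g (i + r) (≤-trans lo≤i (m≤m+n i r)) i+r<hi))

PeriodIn : {B : Set} → (ℕ → B) → ℕ → ℕ → ℕ → Set
PeriodIn f lo hi r = 1 ≤ r × lo + r ≤ hi × PeriodOn f lo hi r

MinPeriodIn : {B : Set} → (ℕ → B) → ℕ → ℕ → ℕ → Set
MinPeriodIn f lo hi r = PeriodIn f lo hi r × (∀ q → PeriodIn f lo hi q → r ≤ q)

module _ {B : Set} {f : ℕ → B} where

  minPeriodIn-extend : ∀ {lo hi lo' hi' p} → MinPeriodIn f lo hi p → lo' ≤ lo → hi ≤ hi' →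
                       PeriodOn f lo' hi' p → MinPeriodIn f lo' hi' p
  minPeriodIn-extend {lo} {hi} {lo'} {hi'} {p} ((1≤p , lo+p≤hi , _) , p-min) lo'≤lo hi≤hi' P =
    (1≤p , ≤-trans (+-monoˡ-≤ p lo'≤lo) (≤-trans lo+p≤hi hi≤hi') , P) , p-min'
    where
      p-min' : ∀ q → PeriodIn f lo' hi' q → p ≤ q
      p-min' q (1≤q , _ , Q) with lo + q ≤? hi
      ... | yes fits = p-min q (1≤q , fits , periodOn-restrict f Q lo'≤lo hi≤hi')
      ... | no  long = <⇒≤ (+-cancelˡ-< lo p q (≤-<-trans lo+p≤hi (≰⇒> long)))

  minPeriodIn-transport : ∀ {n x y r} → SameWindow f n x y → MinPeriodIn f x (x + n) r → MinPeriodIn f y (y + n) r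
  minPeriodIn-transport {n} {x} {y} E ((1≤r , x+r≤x+n , P) , r-min) =
    (1≤r , +-monoʳ-≤ y (+-cancelˡ-≤ x _ n x+r≤x+n) , periodOn-transport f E ≤-refl P) ,
    λ q (1≤q , y+q≤y+n , Q) →
      r-min q (1≤q , +-monoʳ-≤ x (+-cancelˡ-≤ y q n y+q≤y+n) , periodOn-transport f (sameWindow-sym f E) ≤-refl Q)

  minPeriodIn-window : ∀ {lo hi p w m q} → MinPeriodIn f lo hi p → lo ≤ w → w + m ≤ hi → p + p ≤ m →
                       1 ≤ q → PeriodOn f w (w + m) q → p ≤ q
  minPeriodIn-window {lo} {hi} {p} {w} {m} {q} ((1≤p , lo+p≤hi , Pp) , p-min) lo≤w w+m≤hi 2p≤m 1≤q Pq with p ≤? q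
  ... | yes p≤q = p≤q
  ... | no  p≰q = viaCommonDivisor (≰⇒> p≰q)
    where
      -- a common divisor g of p and q spreads from the window to all of [lo, hi) along p
      viaCommonDivisor : q < p → p ≤ q
      viaCommonDivisor q<p with fine-wilf f p q 1≤p 1≤q (periodOn-restrict f Pp lo≤w w+m≤hi) Pq
                                  (+-monoʳ-≤ w (≤-trans (+-monoʳ-≤ p (<⇒≤ q<p)) 2p≤m))
      ... | g , 1≤g , _ , g∣q , Pg = ≤-trans p≤g g≤q
        where
          g≤q : g ≤ q
          g≤q = ∣⇒≤ ⦃ >-nonZero 1≤q ⦄ g∣q
          w+p+g<w+m : w + p + g < w + m
          w+p+g<w+m = subst (_< w + m) (sym (+-assoc w p g))
                        (+-monoʳ-< w (<-≤-trans (+-monoʳ-< p (≤-<-trans g≤q q<p)) 2p≤m))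
          p≤g : p ≤ g
          p≤g = p-min g (1≤g , ≤-trans (+-monoʳ-≤ lo (≤-trans g≤q (<⇒≤ q<p))) lo+p≤hi ,
                  periodOn-propagate f Pp 1≤p lo≤w (<-≤-trans w+p+g<w+m w+m≤hi)
                    (periodOn-restrict f Pg ≤-refl (<⇒≤ w+p+g<w+m)))

-- Strings, windows and fragments

module _ {A : Set} where

  at-take : ∀ n (xs : List A) i → i < n → at (take n xs) i ≡ at xs i
  at-take (suc n) []       i       _       = refl
  at-take (suc n) (x ∷ xs) zero    _       = refl
  at-take (suc n) (x ∷ xs) (suc i) (s≤s i<n) = at-take n xs i i<n

  at-take-≥ : ∀ n (xs : List A) i → n ≤ i → at (take n xs) i ≡ nothing
  at-take-≥ zero    xs       i       _         = refl
  at-take-≥ (suc n) []       i       _         = refl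
  at-take-≥ (suc n) (x ∷ xs) (suc i) (s≤s n≤i) = at-take-≥ n xs i n≤i

  at-drop : ∀ n (xs : List A) i → at (drop n xs) i ≡ at xs (n + i)
  at-drop zero    xs       i = refl
  at-drop (suc n) []       i = refl
  at-drop (suc n) (x ∷ xs) i = at-drop n xs i

  at-++ˡ : ∀ (xs ys : List A) i → i < length xs → at (xs ++ ys) i ≡ at xs i
  at-++ˡ (x ∷ xs) ys zero    _         = refl
  at-++ˡ (x ∷ xs) ys (suc i) (s≤s i<n) = at-++ˡ xs ys i i<n

  at-++ʳ : ∀ (xs ys : List A) i → at (xs ++ ys) (length xs + i) ≡ at ys i
  at-++ʳ []       ys i = refl
  at-++ʳ (x ∷ xs) ys i = at-++ʳ xs ys i

  at-ext : ∀ {xs ys : List A} → (∀ i → at xs i ≡ at ys i) → xs ≡ ys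
  at-ext {[]}     {[]}     _ = refl
  at-ext {[]}     {y ∷ ys} E with () ← E 0
  at-ext {x ∷ xs} {[]}     E with () ← E 0
  at-ext {x ∷ xs} {y ∷ ys} E with refl ← E 0 = cong (x ∷_) (at-ext (λ i → E (suc i)))

  take-+ : ∀ m n (xs : List A) → take (m + n) xs ≡ take m xs ++ take n (drop m xs)
  take-+ zero    n xs       = refl
  take-+ (suc m) n []       = sym (take-[] n)
  take-+ (suc m) n (x ∷ xs) = cong (x ∷_) (take-+ m n xs)

  window : List A → ℕ → ℕ → List A
  window T a n = take n (drop a T)

  at-window : ∀ T a n i → i < n → at (window T a n) i ≡ at T (a + i)
  at-window T a n i i<n = trans (at-take n (drop a T) i i<n) (at-drop a T i)

  length-window : ∀ T a n → a + n ≤ length T → length (window T a n) ≡ n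
  length-window T a n a+n≤ = trans (length-take n (drop a T))
    (m≤n⇒m⊓n≡m (subst (n ≤_) (sym (length-drop a T)) (m+n≤o⇒m≤o∸n n (subst (_≤ length T) (+-comm a n) a+n≤))))

  window-cong : ∀ T {n x y} → SameWindow (at T) n x y → window T x n ≡ window T y n
  window-cong T {n} {x} {y} E = at-ext same
    where
      same : ∀ i → at (window T x n) i ≡ at (window T y n) i
      same i with i <? n
      ... | yes i<n = trans (at-window T x n i i<n) (trans (E i i<n) (sym (at-window T y n i i<n)))
      ... | no  i≮n = trans (at-take-≥ n _ i (≮⇒≥ i≮n)) (sym (at-take-≥ n _ i (≮⇒≥ i≮n)))

  window-+ : ∀ T a m n → window T a (m + n) ≡ window T a m ++ window T (a + m) n
  window-+ T a m n = trans (take-+ m n (drop a T)) (cong (λ xs → window T a m ++ take n xs) (drop-drop a m T))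

  frag-window : ∀ T a n → 1 ≤ n → frag T a (a + n ∸ 1) ≡ window T a n
  frag-window T a (suc n) _ = cong (λ m → take m (drop a T)) length≡
    where
      length≡ : suc (a + suc n ∸ 1) ∸ a ≡ suc n
      length≡ = begin
        suc (a + suc n ∸ 1) ∸ a ≡⟨ cong (λ m → suc (m ∸ 1) ∸ a) (+-suc a n) ⟩
        suc (a + n) ∸ a         ≡⟨ cong (_∸ a) (+-suc a n) ⟨
        a + suc n ∸ a           ≡⟨ m+n∸m≡n a (suc n) ⟩
        suc n                   ∎

  isPeriod-window⇔ : ∀ T a n {r} → a + n ≤ length T → IsPeriod (window T a n) r ⇔ PeriodIn (at T) a (a + n) r
  isPeriod-window⇔ T a n {r} a+n≤ = mk⇔ to from
    where
      W = window T a n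
      len : length W ≡ n
      len = length-window T a n a+n≤
      at-W : ∀ t → t < n → at W t ≡ at T (a + t)
      at-W = at-window T a n

      to : IsPeriod W r → PeriodIn (at T) a (a + n) r
      to (1≤r , r≤len , P) = 1≤r , +-monoʳ-≤ a (subst (r ≤_) len r≤len) , on
        where
          on : PeriodOn (at T) a (a + n) r
          on j a≤j lt with m≤n⇒∃[o]m+o≡n a≤j
          ... | t , refl = begin
            at T (a + t)       ≡⟨ at-W t (≤-<-trans (m≤m+n t r) t+r<n) ⟨
            at W t             ≡⟨ P t (subst (t + r <_) (sym len) t+r<n) ⟩
            at W (t + r)       ≡⟨ at-W (t + r) t+r<n ⟩
            at T (a + (t + r)) ≡⟨ cong (at T) (+-assoc a t r) ⟨
            at T (a + t + r)   ∎
            where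
              t+r<n : t + r < n
              t+r<n = +-cancelˡ-< a (t + r) n (subst (_< a + n) (+-assoc a t r) lt)

      from : PeriodIn (at T) a (a + n) r → IsPeriod W r
      from (1≤r , a+r≤a+n , on) = 1≤r , subst (r ≤_) (sym len) (+-cancelˡ-≤ a r n a+r≤a+n) , P
        where
          P : ∀ t → t + r < length W → at W t ≡ at W (t + r)
          P t lt = begin
            at W t             ≡⟨ at-W t (≤-<-trans (m≤m+n t r) t+r<n) ⟩
            at T (a + t)       ≡⟨ on (a + t) (m≤m+n a t) (subst (_< a + n) (sym (+-assoc a t r)) (+-monoʳ-< a t+r<n)) ⟩
            at T (a + t + r)   ≡⟨ cong (at T) (+-assoc a t r) ⟩
            at T (a + (t + r)) ≡⟨ at-W (t + r) t+r<n ⟨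
            at W (t + r)       ∎
            where
              t+r<n : t + r < n
              t+r<n = subst (t + r <_) len lt

  per-window⇔ : ∀ T a n {r} → a + n ≤ length T → Per (window T a n) r ⇔ MinPeriodIn (at T) a (a + n) r
  per-window⇔ T a n a+n≤ = mk⇔
    (λ (P , r-min) → to P , λ q Q → r-min q (from Q))
    (λ (P , r-min) → from P , λ q Q → r-min q (to Q))
    where
      to : ∀ {q} → IsPeriod (window T a n) q → PeriodIn (at T) a (a + n) q
      to = Equivalence.to (isPeriod-window⇔ T a n a+n≤)
      from : ∀ {q} → PeriodIn (at T) a (a + n) q → IsPeriod (window T a n) q
      from = Equivalence.from (isPeriod-window⇔ T a n a+n≤)

  per-frag⇔ : ∀ T {a b r} → a ≤ b → b < length T → Per (frag T a b) r ⇔ MinPeriodIn (at T) a (suc b) r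
  per-frag⇔ T {a} {b} {r} a≤b b<len = subst (λ hi → Per (frag T a b) r ⇔ MinPeriodIn (at T) a hi r) a+n≡
                                         (per-window⇔ T a (suc b ∸ a) (subst (_≤ length T) (sym a+n≡) b<len))
    where
      a+n≡ : a + (suc b ∸ a) ≡ suc b
      a+n≡ = m+[n∸m]≡n (≤-trans a≤b (n≤1+n b))

  length-frag : ∀ T {a b} → a ≤ b → b < length T → length (frag T a b) ≡ suc b ∸ a
  length-frag T {a} {b} a≤b b<len = length-window T a (suc b ∸ a) (subst (_≤ length T) (sym (m+[n∸m]≡n (m≤n⇒m≤1+n a≤b))) b<len)

  periodic-frag : ∀ T {a b p} → a ≤ b → b < length T → Per (frag T a b) p → a + (p + p) ≤ suc b → Periodic (frag T a b)
  periodic-frag T {a} {b} {p} a≤b b<len P fits =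
    p , P , subst (λ n → 2 * p ≤ n) (sym (length-frag T a≤b b<len))
              (subst (_≤ suc b ∸ a) (sym (cong (p +_) (+-identityʳ p))) (m+n≤o⇒m≤o∸n (p + p) (subst (_≤ suc b) (+-comm a (p + p)) fits)))

  per-unique : ∀ {S : List A} {p q} → Per S p → Per S q → p ≡ q
  per-unique (Pp , p-min) (Pq , q-min) = ≤-antisym (p-min _ Pq) (q-min _ Pp)

  per⇔minPeriodIn : ∀ {S : List A} {r} → Per S r ⇔ MinPeriodIn (at S) 0 (length S) r
  per⇔minPeriodIn {S} {r} = subst (λ W → Per W r ⇔ MinPeriodIn (at S) 0 (length S) r) (take-all (length S) S ≤-refl) (per-window⇔ S 0 (length S) ≤-refl)

-- Powers and squares of strings

  length-power : ∀ t (V : List A) → length (concat (replicate t V)) ≡ t * length V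
  length-power zero    V = refl
  length-power (suc t) V = trans (length-++ V) (cong (length V +_) (length-power t V))

  power-prefix : ∀ t (V : List A) i → i < length (concat (replicate t V)) →
                 at (concat (replicate (suc t) V)) i ≡ at (concat (replicate t V)) i
  power-prefix (suc t) V i i<len with i <? length V
  ... | yes i<|V| = trans (at-++ˡ V _ i i<|V|) (sym (at-++ˡ V _ i i<|V|))
  ... | no  i≮|V| with m≤n⇒∃[o]m+o≡n (≮⇒≥ i≮|V|)
  ... | j , refl = begin
    at (V ++ concat (replicate (suc t) V)) (length V + j) ≡⟨ at-++ʳ V _ j ⟩
    at (concat (replicate (suc t) V)) j                   ≡⟨ power-prefix t V j j<len ⟩
    at (concat (replicate t V)) j                         ≡⟨ at-++ʳ V _ j ⟨
    at (V ++ concat (replicate t V)) (length V + j)       ∎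
    where
      j<len : j < length (concat (replicate t V))
      j<len = +-cancelˡ-< (length V) j _ (subst (length V + j <_) (length-++ V) i<len)

  power-period : ∀ t (V : List A) → PeriodOn (at (concat (replicate t V))) 0 (length (concat (replicate t V))) (length V)
  power-period zero    V i _ ()
  power-period (suc t) V i _ lt = begin
    at (concat (replicate (suc t) V)) i              ≡⟨ power-prefix t V i i<len ⟩
    at (concat (replicate t V)) i                    ≡⟨ at-++ʳ V _ i ⟨
    at (V ++ concat (replicate t V)) (length V + i)  ≡⟨ cong (at (V ++ concat (replicate t V))) (+-comm (length V) i) ⟩
    at (concat (replicate (suc t) V)) (i + length V) ∎
    where
      i<len : i < length (concat (replicate t V))
      i<len = +-cancelˡ-< (length V) i _ (subst₂ _<_ (+-comm i (length V)) (length-++ V) lt)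

  periodOn-drop : ∀ {S : List A} {g r} → g ≤ length S → PeriodOn (at S) 0 (length S) r →
                  PeriodOn (at (drop g S)) 0 (length (drop g S)) r
  periodOn-drop {S} {g} {r} g≤len P i _ lt = begin
    at (drop g S) i       ≡⟨ at-drop g S i ⟩
    at S (g + i)          ≡⟨ P (g + i) z≤n (subst (_< length S) (sym (+-assoc g i r)) inside) ⟩
    at S (g + i + r)      ≡⟨ cong (at S) (+-assoc g i r) ⟩
    at S (g + (i + r))    ≡⟨ at-drop g S (i + r) ⟨
    at (drop g S) (i + r) ∎
    where
      inside : g + (i + r) < length S
      inside = subst (_≤ length S) (cong suc (+-comm (i + r) g))
                 (m≤o∸n⇒m+n≤o (suc (i + r)) g≤len (subst (i + r <_) (length-drop g S) lt))

  power-decomposition : ∀ m (S : List A) {g} → length S ≡ m * g → PeriodOn (at S) 0 (length S) g →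
                        S ≡ concat (replicate m (take g S))
  power-decomposition zero          []      _   _ = refl
  power-decomposition (suc zero)    S {g} len _ = begin
    S              ≡⟨ take-all g S (≤-reflexive (trans len (+-identityʳ g))) ⟨
    take g S       ≡⟨ ++-identityʳ (take g S) ⟨
    take g S ++ [] ∎
  power-decomposition (suc (suc m)) S {g} len P = begin
    S                                                          ≡⟨ take++drop≡id g S ⟨
    take g S ++ drop g S                                       ≡⟨ cong (take g S ++_) (power-decomposition (suc m) (drop g S) len' P') ⟩
    take g S ++ concat (replicate (suc m) (take g (drop g S))) ≡⟨ cong (λ V → take g S ++ concat (replicate (suc m) V)) head≡ ⟩
    concat (replicate (suc (suc m)) (take g S))                ∎
    where
      g≤len : g ≤ length S
      g≤len = subst (g ≤_) (sym len) (m≤m+n g _)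
      len' : length (drop g S) ≡ suc m * g
      len' = trans (length-drop g S) (trans (cong (_∸ g) len) (m+n∸m≡n g _))
      P' : PeriodOn (at (drop g S)) 0 (length (drop g S)) g
      P' = periodOn-drop g≤len P
      head≡ : take g (drop g S) ≡ take g S
      head≡ = window-cong S λ i i<g →
        trans (cong (at S) (+-comm g i))
              (sym (P i z≤n (subst (i + g <_) (sym len) (<-≤-trans (+-monoˡ-< g i<g) (+-monoʳ-≤ g (m≤m+n g (m * g)))))))

  power-+ : ∀ m n (V : List A) → concat (replicate (m + n) V) ≡ concat (replicate m V) ++ concat (replicate n V)
  power-+ zero    n V = refl
  power-+ (suc m) n V = trans (cong (V ++_) (power-+ m n V)) (sym (++-assoc V _ _))

  module _ {U V : List A} where

    prefix-agree : ∀ i → 0 ≤ i → i < length U → at (U ++ V) i ≡ at U i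
    prefix-agree i _ = at-++ˡ U V i

    periodOn-prefix : ∀ {r} → PeriodOn (at (U ++ V)) 0 (length U) r → PeriodOn (at U) 0 (length U) r
    periodOn-prefix = periodOn-agree (at (U ++ V)) prefix-agree

    periodOn-prefix⁻ : ∀ {r} → PeriodOn (at U) 0 (length U) r → PeriodOn (at (U ++ V)) 0 (length U) r
    periodOn-prefix⁻ = periodOn-agree (at U) (λ i 0≤i i<len → sym (prefix-agree i 0≤i i<len))

  nonempty⇒1≤length : ∀ {U : List A} → U ≢ [] → 1 ≤ length U
  nonempty⇒1≤length {[]}    U≢[] = ⊥-elim (U≢[] refl)
  nonempty⇒1≤length {_ ∷ _} _    = s≤s z≤n

  module _ {U : List A} where

    private
      k = length U

    length-square : length (U ++ U) ≡ k + k
    length-square = length-++ U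

    square-period : PeriodOn (at (U ++ U)) 0 (length (U ++ U)) k
    square-period i _ lt = begin
      at (U ++ U) i       ≡⟨ at-++ˡ U U i i<k ⟩
      at U i              ≡⟨ at-++ʳ U U i ⟨
      at (U ++ U) (k + i) ≡⟨ cong (at (U ++ U)) (+-comm k i) ⟩
      at (U ++ U) (i + k) ∎
      where
        i<k : i < k
        i<k = +-cancelʳ-< k i k (subst (i + k <_) length-square lt)

    square-isPeriod : 1 ≤ k → IsPeriod (U ++ U) k
    square-isPeriod 1≤k = 1≤k , subst (k ≤_) (sym length-square) (m≤m+n k k) , λ i → square-period i z≤n

    per-square⇒primitive : Per (U ++ U) k → Primitive U
    per-square⇒primitive ((1≤k , _ , _) , k-min) = nonempty , exponent-one
      where
        nonempty : U ≢ []
        nonempty U≡[] with () ← subst (λ W → 1 ≤ length W) U≡[] 1≤k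
        exponent-one : ∀ V t → 1 ≤ t → U ≡ concat (replicate t V) → t ≡ 1
        exponent-one V (suc zero)    _ _    = refl
        exponent-one V (suc (suc t)) _ U≡Vᵗ = ⊥-elim (<⇒≱ |V|<k (k-min (length V) V-period))
          where
            v = length V
            k≡ : k ≡ suc (suc t) * v
            k≡ = trans (cong length U≡Vᵗ) (length-power (suc (suc t)) V)
            1≤v : 1 ≤ v
            1≤v = n≢0⇒n>0 λ v≡0 → <⇒≢ 1≤k (sym (trans k≡ (trans (cong (suc (suc t) *_) v≡0) (*-zeroʳ (suc (suc t))))))
            |V|<k : v < k
            |V|<k = subst (v <_) (sym k≡) (m<m+n v (≤-trans 1≤v (m≤m+n v (t * v))))
            UU≡ : U ++ U ≡ concat (replicate (suc (suc t) + suc (suc t)) V)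
            UU≡ = trans (cong₂ _++_ U≡Vᵗ U≡Vᵗ) (sym (power-+ (suc (suc t)) (suc (suc t)) V))
            V-period : IsPeriod (U ++ U) v
            V-period = 1≤v , ≤-trans (<⇒≤ |V|<k) (subst (k ≤_) (sym length-square) (m≤m+n k k)) ,
                       λ i lt → subst (λ W → at W i ≡ at W (i + v)) (sym UU≡)
                                  (power-period (suc (suc t) + suc (suc t)) V i z≤n (subst (λ W → i + v < length W) UU≡ lt))

    primitive⇒per-square : Primitive U → Per (U ++ U) k
    primitive⇒per-square (nonempty , exponent-one) = square-isPeriod 1≤k , k-min
      where
        1≤k : 1 ≤ k
        1≤k = nonempty⇒1≤length nonempty
        k-min : ∀ q → IsPeriod (U ++ U) q → k ≤ q
        k-min q (1≤q , _ , Pq) with k ≤? q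
        ... | yes k≤q = k≤q
        ... | no  k≰q with fine-wilf (at (U ++ U)) q k 1≤q 1≤k (λ i _ → Pq i) square-period
                             (subst (q + k ≤_) (sym length-square) (+-monoˡ-≤ k (<⇒≤ (≰⇒> k≰q))))
        ... | g , 1≤g , g∣q , divides m k≡m*g , Pg = ⊥-elim (k≰q (subst (_≤ q) (sym k≡g) (∣⇒≤ ⦃ >-nonZero 1≤q ⦄ g∣q)))
          where
            U-period : PeriodOn (at U) 0 (length U) g
            U-period = periodOn-prefix {U = U} {V = U} (periodOn-restrict (at (U ++ U)) Pg ≤-refl (subst (k ≤_) (sym length-square) (m≤m+n k k)))
            m≡1 : m ≡ 1
            m≡1 = exponent-one (take g U) m (n≢0⇒n>0 λ m≡0 → <⇒≢ 1≤k (sym (trans k≡m*g (cong (_* g) m≡0))))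
                    (power-decomposition m U k≡m*g U-period)
            k≡g : k ≡ g
            k≡g = trans k≡m*g (trans (cong (_* g) m≡1) (*-identityˡ g))

    per-square<⇒per-root : ∀ {r p} → Per (U ++ U) r → Per U p → r < k → r ≡ p
    per-square<⇒per-root {r} {p} PerUU PerU r<k with m≤n⇒∃[o]m+o≡n (<⇒≤ r<k)
    ... | d , r+d≡k = ≤-antisym r≤p p≤r
      where
        f = at (U ++ U)
        hi = length (U ++ U)
        MUU : MinPeriodIn f 0 hi r
        MUU = Equivalence.to (per⇔minPeriodIn {S = U ++ U}) PerUU
        MU : MinPeriodIn (at U) 0 k p
        MU = Equivalence.to (per⇔minPeriodIn {S = U}) PerU
        1≤r = proj₁ (proj₁ MUU)
        Pr = proj₂ (proj₂ (proj₁ MUU))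
        1≤p = proj₁ (proj₁ MU)
        Pp = proj₂ (proj₂ (proj₁ MU))
        k≤hi : k ≤ hi
        k≤hi = subst (k ≤_) (sym length-square) (m≤m+n k k)
        p≤r : p ≤ r
        p≤r = proj₂ MU r (1≤r , <⇒≤ r<k , periodOn-prefix {U = U} {V = U} (periodOn-restrict f Pr ≤-refl k≤hi))
        d-period : PeriodOn f 0 hi d
        d-period = periodOn-difference f r d Pr (subst (PeriodOn f 0 hi) (sym r+d≡k) square-period)
                     (subst (r + (r + d) ≤_) (sym length-square) (+-mono-≤ (<⇒≤ r<k) (≤-reflexive r+d≡k)))
        r≤d : r ≤ d
        r≤d = proj₂ MUU d (m<m+n⇒0<n r d (subst (r <_) (sym r+d≡k) r<k) ,
                           ≤-trans (m≤n+m d r) (≤-trans (≤-reflexive r+d≡k) k≤hi) , d-period)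
        r+p≤k : r + p ≤ k
        r+p≤k = ≤-trans (+-monoʳ-≤ r (≤-trans p≤r r≤d)) (≤-reflexive r+d≡k)
        p-period : PeriodOn f 0 hi p
        p-period = periodOn-propagate f Pr 1≤r z≤n
                     (subst (r + p <_) (sym length-square) (≤-<-trans r+p≤k (m<m+n k (≤-trans (s≤s z≤n) r<k))))
                     (periodOn-restrict f (periodOn-prefix⁻ {U = U} {V = U} Pp) ≤-refl r+p≤k)
        r≤p : r ≤ p
        r≤p = proj₂ MUU p (1≤p , ≤-trans (m≤n+m p r) (≤-trans r+p≤k k≤hi) , p-period)

    per-square-≥4⇒special : ∀ {p r} → Per U p → Per (U ++ U) r → 4 * p ≤ r → SpecialSquare U
    per-square-≥4⇒special {p} {r} PerU PerUU 4p≤r with r <? k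
    ... | yes r<k = ⊥-elim (<⇒≱ p<4p (subst (4 * p ≤_) (per-square<⇒per-root PerUU PerU r<k) 4p≤r))
      where
        p<4p : p < 4 * p
        p<4p = m<m+n p (≤-trans (proj₁ (proj₁ PerU)) (m≤m+n p _))
    ... | no  r≮k = per-square⇒primitive (subst (Per (U ++ U)) r≡k PerUU) , p , PerU , subst (4 * p ≤_) r≡k 4p≤r
      where
        r≡k : r ≡ k
        r≡k = ≤-antisym (proj₂ PerUU k (square-isPeriod (≤-trans (proj₁ (proj₁ PerU)) (proj₁ (proj₂ (proj₁ PerU)))))) (≮⇒≥ r≮k)

-- A square occurring in a text

module SquareIn {A : Set} (T : List A) (s k : ℕ) (square : IsSquareAt T s k) where

  1≤k : 1 ≤ k
  1≤k = proj₁ square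

  2k≡k+k : 2 * k ≡ k + k
  2k≡k+k = cong (k +_) (+-identityʳ k)

  s+2k≤len : s + (k + k) ≤ length T
  s+2k≤len = subst (λ n → s + n ≤ length T) 2k≡k+k (proj₁ (proj₂ square))

  s+k≤len : s + k ≤ length T
  s+k≤len = ≤-trans (+-monoʳ-≤ s (m≤m+n k k)) s+2k≤len

  U : List A
  U = frag T s (s + k ∸ 1)

  U≡window : U ≡ window T s k
  U≡window = frag-window T s k 1≤k

  length-root : length U ≡ k
  length-root = trans (cong length U≡window) (length-window T s k s+k≤len)

  secondHalf≡window : frag T (s + k) (s + 2 * k ∸ 1) ≡ window T (s + k) k
  secondHalf≡window = begin
    frag T (s + k) (s + 2 * k ∸ 1)       ≡⟨ cong (λ n → frag T (s + k) (n ∸ 1)) (+-assoc s k (k + 0)) ⟨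
    frag T (s + k) (s + k + (k + 0) ∸ 1) ≡⟨ frag-window T (s + k) (k + 0) (≤-trans 1≤k (m≤m+n k 0)) ⟩
    window T (s + k) (k + 0)             ≡⟨ cong (window T (s + k)) (+-identityʳ k) ⟩
    window T (s + k) k                   ∎

  square≡ : frag T s (s + 2 * k ∸ 1) ≡ U ++ U
  square≡ = begin
    frag T s (s + 2 * k ∸ 1)             ≡⟨ frag-window T s (2 * k) (≤-trans 1≤k (m≤m+n k (k + 0))) ⟩
    window T s (k + (k + 0))             ≡⟨ cong (window T s) 2k≡k+k ⟩
    window T s (k + k)                   ≡⟨ window-+ T s k k ⟩
    window T s k ++ window T (s + k) k   ≡⟨ cong₂ _++_ U≡window secondHalf≡window ⟨
    U ++ frag T (s + k) (s + 2 * k ∸ 1) ≡⟨ cong (U ++_) (proj₂ (proj₂ square)) ⟨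
    U ++ U                               ∎

  halves-agree : SameWindow (at T) k s (s + k)
  halves-agree i i<k = begin
    at T (s + i)                  ≡⟨ at-window T s k i i<k ⟨
    at (window T s k) i           ≡⟨ cong (λ W → at W i) (trans (sym U≡window) (trans (proj₂ (proj₂ square)) secondHalf≡window)) ⟩
    at (window T (s + k) k) i     ≡⟨ at-window T (s + k) k i i<k ⟩
    at T (s + k + i)              ∎

  square-periodIn : PeriodIn (at T) s (s + (k + k)) k
  square-periodIn = 1≤k , +-monoʳ-≤ s (m≤m+n k k) , periodic
    where
      periodic : PeriodOn (at T) s (s + (k + k)) k
      periodic i s≤i lt with m≤n⇒∃[o]m+o≡n s≤i
      ... | t , refl = trans (halves-agree t t<k) (cong (at T) (solve (s ∷ k ∷ t ∷ [])))
        where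
          t<k : t < k
          t<k = +-cancelʳ-< k t k (+-cancelˡ-< s (t + k) (k + k) (subst (_< s + (k + k)) (+-assoc s t k) lt))

  per-root⇔ : ∀ {r} → Per U r ⇔ MinPeriodIn (at T) s (s + k) r
  per-root⇔ {r} = subst (λ W → Per W r ⇔ MinPeriodIn (at T) s (s + k) r) (sym U≡window) (per-window⇔ T s k s+k≤len)

  per-square⇔ : ∀ {r} → Per (frag T s (s + 2 * k ∸ 1)) r ⇔ MinPeriodIn (at T) s (s + (k + k)) r
  per-square⇔ {r} = subst (λ W → Per W r ⇔ MinPeriodIn (at T) s (s + (k + k)) r)
                      (sym (trans (frag-window T s (2 * k) (≤-trans 1≤k (m≤m+n k (k + 0)))) (cong (window T s) 2k≡k+k)))
                      (per-window⇔ T s (k + k) s+2k≤len)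

-- Runs as maximal periodic extensions

isRun-intro : ∀ {A : Set} (T : List A) {a b p} → a ≤ b → b < length T → MinPeriodIn (at T) a (suc b) p →
              a + (p + p) ≤ suc b → (a ≡ 0 ⊎ at T (a ∸ 1) ≢ at T (a ∸ 1 + p)) →
              (suc b ≡ length T ⊎ at T (suc b) ≢ at T (suc b ∸ p)) → IsRun T a b
isRun-intro T a≤b b<len M fits leftMaximal rightMaximal =
  (a≤b , b<len) , periodic-frag T a≤b b<len P fits , _ , P , leftMaximal , rightMaximal
  where
    P = Equivalence.from (per-frag⇔ T a≤b b<len) M

record RunAround {A : Set} (T : List A) (p lo hi : ℕ) : Set where
  field
    start end       : ℕ
    start≤lo        : start ≤ lo
    hi≤1+end        : hi ≤ suc end
    isRun           : IsRun T start end
    minPeriod       : MinPeriodIn (at T) start (suc end) p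

  start≤end : start ≤ end
  start≤end = proj₁ (proj₁ isRun)

  end<length : end < length T
  end<length = proj₂ (proj₁ isRun)

  periodic : PeriodOn (at T) start (suc end) p
  periodic = proj₂ (proj₂ (proj₁ minPeriod))

  per : Per (frag T start end) p
  per = Equivalence.from (per-frag⇔ T start≤end end<length) minPeriod

module MaximalExtension {A : Set} (_≟_ : DecidableEquality A) (T : List A) (p : ℕ) where

  private
    _≟ₘ_ : DecidableEquality (Maybe A)
    _≟ₘ_ = ≡-dec _≟_

  leftEnd : ℕ → ℕ
  leftEnd zero    = zero
  leftEnd (suc a) with at T a ≟ₘ at T (a + p)
  ... | yes _ = leftEnd a
  ... | no  _ = suc a

  leftEnd-≤ : ∀ x → leftEnd x ≤ x
  leftEnd-≤ zero    = z≤n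
  leftEnd-≤ (suc a) with at T a ≟ₘ at T (a + p)
  ... | yes _ = m≤n⇒m≤1+n (leftEnd-≤ a)
  ... | no  _ = ≤-refl

  leftEnd-periodic : ∀ x i → leftEnd x ≤ i → i < x → at T i ≡ at T (i + p)
  leftEnd-periodic (suc a) i a≤i i<x with at T a ≟ₘ at T (a + p)
  ... | no  _ = ⊥-elim (<⇒≱ i<x a≤i)
  ... | yes eq with i <? a
  ...   | yes i<a = leftEnd-periodic a i a≤i i<a
  ...   | no  i≮a rewrite ≤-antisym (s≤s⁻¹ i<x) (≮⇒≥ i≮a) = eq

  leftEnd-maximal : ∀ x → leftEnd x ≡ 0 ⊎ at T (leftEnd x ∸ 1) ≢ at T (leftEnd x ∸ 1 + p)
  leftEnd-maximal zero    = inj₁ refl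
  leftEnd-maximal (suc a) with at T a ≟ₘ at T (a + p)
  ... | yes _  = leftEnd-maximal a
  ... | no  ≢p = inj₂ ≢p

  rightEnd : ℕ → ℕ → ℕ
  rightEnd zero    b = b
  rightEnd (suc n) b with at T (suc b) ≟ₘ at T (suc b ∸ p)
  ... | yes _ = rightEnd n (suc b)
  ... | no  _ = b

  rightEnd-≥ : ∀ n b → b ≤ rightEnd n b
  rightEnd-≥ zero    b = ≤-refl
  rightEnd-≥ (suc n) b with at T (suc b) ≟ₘ at T (suc b ∸ p)
  ... | yes _ = ≤-trans (n≤1+n b) (rightEnd-≥ n (suc b))
  ... | no  _ = ≤-refl

  rightEnd-< : ∀ n b → n + suc b ≡ length T → rightEnd n b < length T
  rightEnd-< zero    b eq = ≤-reflexive eq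
  rightEnd-< (suc n) b eq with at T (suc b) ≟ₘ at T (suc b ∸ p)
  ... | yes _ = rightEnd-< n (suc b) (trans (+-suc n (suc b)) eq)
  ... | no  _ = ≤-trans (m≤n+m (suc b) n) (≤-trans (n≤1+n _) (≤-reflexive eq))

  rightEnd-periodic : ∀ n b j → b < j → j ≤ rightEnd n b → at T j ≡ at T (j ∸ p)
  rightEnd-periodic zero    b j b<j j≤b = ⊥-elim (<⇒≱ b<j j≤b)
  rightEnd-periodic (suc n) b j b<j j≤b with at T (suc b) ≟ₘ at T (suc b ∸ p)
  ... | no  _  = ⊥-elim (<⇒≱ b<j j≤b)
  ... | yes eq with suc b <? j
  ...   | yes b+1<j = rightEnd-periodic n (suc b) j b+1<j j≤b
  ...   | no  b+1≮j rewrite ≤-antisym (≮⇒≥ b+1≮j) b<j = eq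

  rightEnd-maximal : ∀ n b → n + suc b ≡ length T →
                     suc (rightEnd n b) ≡ length T ⊎ at T (suc (rightEnd n b)) ≢ at T (suc (rightEnd n b) ∸ p)
  rightEnd-maximal zero    b eq = inj₁ eq
  rightEnd-maximal (suc n) b eq with at T (suc b) ≟ₘ at T (suc b ∸ p)
  ... | yes _  = rightEnd-maximal n (suc b) (trans (+-suc n (suc b)) eq)
  ... | no  ≢p = inj₂ ≢p

  runAround : ∀ {lo hi} → hi ≤ length T → MinPeriodIn (at T) lo hi p → lo + (p + p) ≤ hi → RunAround T p lo hi
  runAround {lo} {zero} _ ((1≤p , _) , _) fits = ⊥-elim (<⇒≱ (≤-trans 1≤p (m≤m+n p p)) (m+n≤o⇒n≤o lo fits))
  runAround {lo} {suc e} hi≤len M fits = record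
    { start     = a
    ; end       = b
    ; start≤lo  = leftEnd-≤ lo
    ; hi≤1+end  = s≤s (rightEnd-≥ n e)
    ; isRun     = isRun-intro T a≤b (rightEnd-< n e n+1+e≡len) minPeriod
                    (≤-trans (+-monoˡ-≤ (p + p) (leftEnd-≤ lo)) (≤-trans fits (s≤s (rightEnd-≥ n e))))
                    (leftEnd-maximal lo) (rightEnd-maximal n e n+1+e≡len)
    ; minPeriod = minPeriod
    }
    where
      n = length T ∸ suc e
      n+1+e≡len : n + suc e ≡ length T
      n+1+e≡len = m∸n+n≡m hi≤len
      a = leftEnd lo
      b = rightEnd n e
      a≤b : a ≤ b
      a≤b = ≤-trans (leftEnd-≤ lo) (≤-trans (s≤s⁻¹ (<-≤-trans (m<m+n lo (≤-trans (proj₁ (proj₁ M)) (m≤m+n p p))) fits)) (rightEnd-≥ n e))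
      periodic : PeriodOn (at T) a (suc b) p
      periodic i a≤i i+p≤b with i <? lo
      ... | yes i<lo = leftEnd-periodic lo i a≤i i<lo
      ... | no  i≮lo with i + p <? suc e
      ...   | yes i+p≤e = proj₂ (proj₂ (proj₁ M)) i (≮⇒≥ i≮lo) i+p≤e
      ...   | no  i+p≰e = sym (trans (rightEnd-periodic n e (i + p) (≮⇒≥ i+p≰e) (s≤s⁻¹ i+p≤b)) (cong (at T) (m+n∸n≡m i p)))
      minPeriod : MinPeriodIn (at T) a (suc b) p
      minPeriod = minPeriodIn-extend M (leftEnd-≤ lo) (s≤s (rightEnd-≥ n e)) periodic

-- Lyndon roots via the factors of length p

Factor : {A : Set} → List A → ℕ → ℕ → ℕ → List A → Set
Factor T p lo hi L = ∃ λ x → lo ≤ x × x + p ≤ hi × L ≡ window T x p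

module _ {A : Set} where

  rotate-window : ∀ (T : List A) {a e} j c → PeriodOn (at T) a e (j + c) → a + (j + c) + j ≤ e →
                  drop j (window T a (j + c)) ++ take j (window T a (j + c)) ≡ window T (a + j) (j + c)
  rotate-window T {a} j c P bound = begin
    drop j (window T a (j + c)) ++ take j (window T a (j + c)) ≡⟨ cong₂ _++_ drop≡ take≡ ⟩
    window T (a + j) c ++ window T a j                         ≡⟨ cong (window T (a + j) c ++_) (window-cong T shifted) ⟩
    window T (a + j) c ++ window T (a + j + c) j               ≡⟨ window-+ T (a + j) c j ⟨
    window T (a + j) (c + j)                                   ≡⟨ cong (window T (a + j)) (+-comm c j) ⟩
    window T (a + j) (j + c)                                   ∎
    where
      drop≡ : drop j (window T a (j + c)) ≡ window T (a + j) c
      drop≡ = trans (sym (take-drop c j (drop a T))) (cong (take c) (drop-drop a j T))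
      take≡ : take j (window T a (j + c)) ≡ window T a j
      take≡ = trans (take-take j (j + c) (drop a T)) (cong (λ n → take n (drop a T)) (m≤n⇒m⊓n≡m (m≤m+n j c)))
      shifted : SameWindow (at T) j a (a + j + c)
      shifted = subst (SameWindow (at T) j a) (sym (+-assoc a j c)) (periodOn-shift (at T) P ≤-refl bound)

  module _ (T : List A) {a e p} (P : PeriodOn (at T) a e p) (1≤p : 1 ≤ p) (a+2p≤e : a + (p + p) ≤ e) (e≤len : e ≤ length T) where

    private
      a+p+p≤e : a + p + p ≤ e
      a+p+p≤e = subst (_≤ e) (sym (+-assoc a p p)) a+2p≤e
      length-root : length (window T a p) ≡ p
      length-root = length-window T a p (≤-trans (+-monoʳ-≤ a (m≤m+n p p)) (≤-trans a+2p≤e e≤len))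

    rotation⇒factor : ∀ {L} → IsRotation (window T a p) L → Factor T p a e L
    rotation⇒factor (j , j≤len , refl) with m≤n⇒∃[o]m+o≡n (subst (j ≤_) length-root j≤len)
    ... | c , refl = a + j , m≤m+n a j ,
                     ≤-trans (+-monoˡ-≤ (j + c) (+-monoʳ-≤ a (m≤m+n j c))) a+p+p≤e ,
                     rotate-window T j c P (≤-trans (+-monoʳ-≤ (a + (j + c)) (m≤m+n j c)) a+p+p≤e)

    factor⇒rotation : ∀ {L} → Factor T p a e L → IsRotation (window T a p) L
    factor⇒rotation (x , a≤x , x+p≤e , refl)
      with periodOn-representative (at T) P 1≤p ≤-refl a+p+p≤e x a≤x x+p≤e
    ... | x' , a≤x' , x'<a+p , same with m≤n⇒∃[o]m+o≡n a≤x'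
    ... | j , refl with m≤n⇒∃[o]m+o≡n (<⇒≤ (+-cancelˡ-< a j p x'<a+p))
    ... | c , refl = j , subst (j ≤_) (sym length-root) (m≤m+n j c) ,
                     trans (window-cong T same) (sym (rotate-window T j c P (≤-trans (+-monoʳ-≤ (a + (j + c)) (m≤m+n j c)) a+p+p≤e)))

  private
    y+p+p≤y+m : ∀ y p m → p + p ≤ m → y + p + p ≤ y + m
    y+p+p≤y+m y p m 2p≤m = subst (_≤ y + m) (sym (+-assoc y p p)) (+-monoʳ-≤ y 2p≤m)

  factor-restrict : ∀ (T : List A) {p lo hi y m L} → PeriodOn (at T) lo hi p → 1 ≤ p → lo ≤ y → y + m ≤ hi → p + p ≤ m →
                    Factor T p lo hi L → Factor T p y (y + m) L
  factor-restrict T {p} {y = y} {m = m} P 1≤p lo≤y y+m≤hi 2p≤m (x , lo≤x , x+p≤hi , refl)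
    with periodOn-representative (at T) P 1≤p lo≤y (≤-trans (y+p+p≤y+m y p m 2p≤m) y+m≤hi) x lo≤x x+p≤hi
  ... | x' , y≤x' , x'<y+p , same =
    x' , y≤x' , ≤-trans (+-monoˡ-≤ p (<⇒≤ x'<y+p)) (y+p+p≤y+m y p m 2p≤m) , window-cong T same

  factor-widen : ∀ {T : List A} {p lo hi lo' hi' L} → lo' ≤ lo → hi ≤ hi' → Factor T p lo hi L → Factor T p lo' hi' L
  factor-widen lo'≤lo hi≤hi' (x , lo≤x , x+p≤hi , eq) = x , ≤-trans lo'≤lo lo≤x , ≤-trans x+p≤hi hi≤hi' , eq

  factor-transport : ∀ (T : List A) {p n x y L} → SameWindow (at T) n x y → Factor T p x (x + n) L → Factor T p y (y + n) L
  factor-transport T {p} {n} {x} {y} E (z , x≤z , z+p≤x+n , refl) with m≤n⇒∃[o]m+o≡n x≤z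
  ... | t , refl = y + t , m≤m+n y t , subst (_≤ y + n) (sym (+-assoc y t p)) (+-monoʳ-≤ y t+p≤n) ,
                   window-cong T (λ i i<p → trans (cong (at T) (+-assoc x t i))
                     (trans (E (t + i) (<-≤-trans (+-monoʳ-< t i<p) t+p≤n)) (cong (at T) (sym (+-assoc y t i)))))
    where
      t+p≤n : t + p ≤ n
      t+p≤n = +-cancelˡ-≤ x (t + p) n (subst (_≤ x + n) (+-assoc x t p) z+p≤x+n)

module _ {A : Set} (_≺_ : Rel A 0ℓ) (sto : IsStrictTotalOrder _≡_ _≺_) where

  private
    _≤L_ : List A → List A → Set
    _≤L_ = Lex-≤ _≡_ _≺_
    open IsTotalOrder (Lex.≤-isTotalOrder {_≈_ = _≡_} {_≺_ = _≺_} sto)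
      using () renaming (refl to ≤L-refl; trans to ≤L-trans; total to ≤L-total)

    argmin : ∀ (g : ℕ → List A) n → ∃ λ j → j ≤ n × (∀ j' → j' ≤ n → g j ≤L g j')
    argmin g zero = 0 , z≤n , λ { zero _ → ≤L-refl }
    argmin g (suc n) with argmin g n
    ... | j , j≤n , least with ≤L-total (g j) (g (suc n))
    ...   | inj₁ gj≤ = j , m≤n⇒m≤1+n j≤n , λ j' j'≤1+n → case j' ≤? n of λ where
      (yes j'≤n) → least j' j'≤n
      (no  j'≰n) → subst (λ z → g j ≤L g z) (≤-antisym (≰⇒> j'≰n) j'≤1+n) gj≤
    ...   | inj₂ ≤gj = suc n , ≤-refl , λ j' j'≤1+n → case j' ≤? n of λ where
      (yes j'≤n) → ≤L-trans ≤gj (least j' j'≤n)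
      (no  j'≰n) → subst (λ z → g (suc n) ≤L g z) (≤-antisym (≰⇒> j'≰n) j'≤1+n) ≤L-refl

  least-rotation : (W : List A) → ∃ λ L → IsRotation W L × (∀ L' → IsRotation W L' → L ≤L L')
  least-rotation W with argmin (λ j → drop j W ++ take j W) (length W)
  ... | j , j≤len , least = _ , (j , j≤len , refl) , λ { L' (j' , j'≤len , refl) → least j' j'≤len }

  lyndonRoot-intro : ∀ T {a b p L} → a ≤ b → b < length T → MinPeriodIn (at T) a (suc b) p → a + (p + p) ≤ suc b →
                     IsRotation (window T a p) L → (∀ L' → IsRotation (window T a p) L' → L ≤L L') →
                     LyndonRoot _≺_ (frag T a b) L
  lyndonRoot-intro T {a} {b} {p} a≤b b<len M fits rotation least =
    periodic-frag T a≤b b<len P fits , p , P , subst (λ W → IsRotation W _) (sym root≡) rotation ,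
    λ L' r → least L' (subst (λ W → IsRotation W L') root≡ r)
    where
      P = Equivalence.from (per-frag⇔ T a≤b b<len) M
      root≡ : take p (frag T a b) ≡ window T a p
      root≡ = trans (take-take p (suc b ∸ a) (drop a T))
                (cong (λ n → take n (drop a T)) (m≤n⇒m⊓n≡m (m+n≤o⇒m≤o∸n p (≤-trans (≤-reflexive (+-comm p a)) (≤-trans (+-monoʳ-≤ a (m≤m+n p p)) fits)))))

-- Layers, and the two directions of the theorem

PyramidSquare : {A : Set} → Rel A 0ℓ → List A → ℕ → ℕ → Set
PyramidSquare _≺_ T s k =
  ∃[ a ] ∃[ b ] ∃[ a' ] ∃[ b' ] ∃[ p ] ∃[ L ] ∃[ c ] ∃[ d ]
    (IsRun T a b × IsRun T a' b' × Neighboring a b a' b' ×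
     Per (frag T a b) p × Per (frag T a' b') p ×
     LyndonRoot _≺_ (frag T a b) L × LyndonRoot _≺_ (frag T a' b') L ×
     IsLayer T p a b a' b' c d ×
     InFragSquares T s k (c ⊔ (a ⊓ a')) (d ⊓ (b ⊔ b')) ×
     Per (frag T s (s + k ∸ 1)) p)

module _ {A : Set} (T : List A) (s k : ℕ) (square : IsSquareAt T s k) where
  open SquareIn T s k square

  -- the window covers a piece of length ≥ 2p of one of the two copies of U
  squareWindow-period : ∀ {p q j} → MinPeriodIn (at T) s (s + k) p → 4 * p ≤ k → j < k → 1 ≤ q →
                        PeriodOn (at T) (s + j) (s + j + k) q → p ≤ q
  squareWindow-period {p} {q} {j} MU 4p≤k j<k 1≤q Pq with p + p ≤? j
  ... | yes 2p≤j = minPeriodIn-window MU ≤-refl (+-monoʳ-≤ s (<⇒≤ j<k)) 2p≤j 1≤q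
                     (periodOn-transport (at T) (sameWindow-sym (at T) halves-agree) (<⇒≤ j<k) secondCopy)
    where
      secondCopy : PeriodOn (at T) (s + k) (s + k + j) q
      secondCopy = periodOn-restrict (at T) Pq (+-monoʳ-≤ s (<⇒≤ j<k))
                     (≤-reflexive (trans (+-assoc s k j) (trans (cong (s +_) (+-comm k j)) (sym (+-assoc s j k)))))
  ... | no  2p≰j with m≤n⇒∃[o]m+o≡n (<⇒≤ j<k)
  ... | m , j+m≡k = minPeriodIn-window MU (m≤m+n s j) s+j+m≤s+k 2p≤m 1≤q
                      (periodOn-restrict (at T) Pq ≤-refl (+-monoʳ-≤ (s + j) (≤-trans (m≤n+m m j) (≤-reflexive j+m≡k))))
    where
      s+j+m≤s+k : s + j + m ≤ s + k
      s+j+m≤s+k = ≤-reflexive (trans (+-assoc s j m) (cong (s +_) j+m≡k))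
      2p≤m : p + p ≤ m
      2p≤m = <⇒≤ (+-cancelˡ-< (p + p) (p + p) m (≤-<-trans 4p≤j+m (+-monoˡ-< m (≰⇒> 2p≰j))))
        where
          4p≤j+m : (p + p) + (p + p) ≤ j + m
          4p≤j+m = subst₂ _≤_ (4*n≡2n+2n p) (sym j+m≡k) 4p≤k

  module _ {p c d} (MU : MinPeriodIn (at T) s (s + k) p) (4p≤k : 4 * p ≤ k) (c≤s : c ≤ s) (s+2k≤1+d : s + (k + k) ≤ suc d)
           (PR : PeriodOn (at T) c (suc d) k) where

    layerWindow-period : ∀ {x q} → c ≤ x → x + k ≤ suc d → 1 ≤ q → PeriodOn (at T) x (x + k) q → p ≤ q
    layerWindow-period {x} c≤x x+k≤1+d 1≤q Pq
      with periodOn-representative (at T) PR 1≤k c≤s (subst (_≤ suc d) (sym (+-assoc s k k)) s+2k≤1+d) x c≤x x+k≤1+d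
    ... | x' , s≤x' , x'<s+k , same with m≤n⇒∃[o]m+o≡n s≤x'
    ... | j , refl = squareWindow-period MU 4p≤k (+-cancelˡ-< s j k x'<s+k) 1≤q (periodOn-transport (at T) same ≤-refl Pq)

    layer-subperiod-minimal : Per (frag T c d) k → ∀ s' k' q → InFragSquares T s' k' c d → Per (frag T s' (s' + k' ∸ 1)) q → p ≤ q
    layer-subperiod-minimal PerR s' k' q (square' , c≤s' , end≤d , r , PerXX , PerR') PerX =
      layerWindow-period c≤s' s'+k≤1+d (proj₁ (proj₁ MX)) (periodOn-restrict (at T) (proj₂ (proj₂ (proj₁ MX))) ≤-refl (+-monoʳ-≤ s' k≤k'))
      where
        module X = SquareIn T s' k' square'
        MXX : MinPeriodIn (at T) s' (s' + (k' + k')) k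
        MXX = Equivalence.to X.per-square⇔ (subst (Per (frag T s' (s' + 2 * k' ∸ 1))) (per-unique {S = frag T c d} PerR' PerR) PerXX)
        k≤k' : k ≤ k'
        k≤k' = proj₂ MXX k' X.square-periodIn
        MX : MinPeriodIn (at T) s' (s' + k') q
        MX = Equivalence.to X.per-root⇔ PerX
        s'+k≤1+d : s' + k ≤ suc d
        s'+k≤1+d = ≤-trans (+-monoʳ-≤ s' (≤-trans k≤k' (m≤m+n k' k'))) (subst (_≤ suc d) (cong (s' +_) X.2k≡k+k) (pred-≤⇒≤suc (s' + 2 * k') end≤d))

  pyramid⇒special : ∀ {_≺_ : Rel A 0ℓ} → PyramidSquare _≺_ T s k → SpecialSquare U
  pyramid⇒special (a , b , a' , b' , p , _ , c , d , _ , _ , _ , _ , _ , _ , _ ,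
                   (_ , (q , r , (subperiodWitness , _) , PerR , 4q≤r) , (_ , p-least) , _ , _ , PerR' , PerIntersection') ,
                   (_ , _ , _ , _ , PerUU , PerIntersection'') , PerU) =
    per-square-≥4⇒special PerU (subst (λ W → Per W r) square≡ PerUU') (≤-trans (*-monoʳ-≤ 4 p≤q) 4q≤r)
    where
      p≤q : p ≤ q
      p≤q = let (s₁ , k₁ , squares , PerX) = subperiodWitness in p-least s₁ k₁ q squares PerX
      PerUU' : Per (frag T s (s + 2 * k ∸ 1)) r
      PerUU' = subst (Per (frag T s (s + 2 * k ∸ 1)))
                 (sym (trans (per-unique {S = frag T c d} PerR PerR') (per-unique {S = frag T (c ⊔ (a ⊓ a')) (d ⊓ (b ⊔ b'))} PerIntersection' PerIntersection''))) PerUU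

module Pyramid {A : Set} (_≺_ : Rel A 0ℓ) (sto : IsStrictTotalOrder _≡_ _≺_)
               (T : List A) (s k : ℕ) (square : IsSquareAt T s k) {p : ℕ}
               (U-primitive : Primitive (frag T s (s + k ∸ 1))) (PerU : Per (frag T s (s + k ∸ 1)) p) (4p≤k : 4 * p ≤ k) where

  open SquareIn T s k square
  open IsStrictTotalOrder sto using () renaming (_≟_ to _≟ₐ_)

  MU : MinPeriodIn (at T) s (s + k) p
  MU = Equivalence.to per-root⇔ PerU

  1≤p : 1 ≤ p
  1≤p = proj₁ (proj₁ MU)

  2p≤k : p + p ≤ k
  2p≤k = ≤-trans (m≤m+n (p + p) (p + p)) (subst (_≤ k) (4*n≡2n+2n p) 4p≤k)

  PerUU : Per (frag T s (s + 2 * k ∸ 1)) k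
  PerUU = subst (λ W → Per W k) (sym square≡) (subst (Per (U ++ U)) length-root (primitive⇒per-square U-primitive))

  MUU : MinPeriodIn (at T) s (s + (k + k)) k
  MUU = Equivalence.to per-square⇔ PerUU

  F : RunAround T p s (s + k)
  F = MaximalExtension.runAround _≟ₐ_ T p s+k≤len MU (+-monoʳ-≤ s 2p≤k)

  F' : RunAround T p (s + k) (s + k + k)
  F' = MaximalExtension.runAround _≟ₐ_ T p (subst (_≤ length T) (sym (+-assoc s k k)) s+2k≤len)
         (minPeriodIn-transport halves-agree MU) (+-monoʳ-≤ (s + k) 2p≤k)

  R : RunAround T k s (s + (k + k))
  R = MaximalExtension.runAround _≟ₐ_ T k s+2k≤len MUU ≤-refl

  module F = RunAround F
  module F' = RunAround F'
  module R = RunAround R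

  neighboring : Neighboring F.start F.end F'.start F'.end
  neighboring = s + k , ≤-trans F.start≤lo (≤-trans (m≤m+n s k) (n≤1+n _)) , F.hi≤1+end , F'.start≤lo ,
                s≤s⁻¹ (<-≤-trans (m<m+n (s + k) 1≤k) F'.hi≤1+end)

  L : List A
  L = proj₁ (least-rotation _≺_ sto (window T s p))

  lyndonRoot-covering : ∀ {lo hi} (Q : RunAround T p lo hi) → lo + (p + p) ≤ hi →
                        (∀ {L'} → Factor T p (RunAround.start Q) (suc (RunAround.end Q)) L' → Factor T p s (s + k) L') →
                        (∀ {L'} → Factor T p s (s + k) L' → Factor T p (RunAround.start Q) (suc (RunAround.end Q)) L') →
                        LyndonRoot _≺_ (frag T (RunAround.start Q) (RunAround.end Q)) L
  lyndonRoot-covering Q lo+2p≤hi toU fromU =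
    lyndonRoot-intro _≺_ sto T Q.start≤end Q.end<length Q.minPeriod fits
      (factor⇒rotation T Q.periodic 1≤p fits Q.end<length (fromU (rotation⇒factor T PU 1≤p s+2p≤s+k s+k≤len rotationL)))
      (λ L' r → leastL L' (factor⇒rotation T PU 1≤p s+2p≤s+k s+k≤len (toU (rotation⇒factor T Q.periodic 1≤p fits Q.end<length r))))
    where
      module Q = RunAround Q
      fits : Q.start + (p + p) ≤ suc Q.end
      fits = ≤-trans (+-monoˡ-≤ (p + p) Q.start≤lo) (≤-trans lo+2p≤hi Q.hi≤1+end)
      PU = proj₂ (proj₂ (proj₁ MU))
      s+2p≤s+k = +-monoʳ-≤ s 2p≤k
      rotationL = proj₁ (proj₂ (least-rotation _≺_ sto (window T s p)))
      leastL = proj₂ (proj₂ (least-rotation _≺_ sto (window T s p)))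

  lyndonRoot-F : LyndonRoot _≺_ (frag T F.start F.end) L
  lyndonRoot-F = lyndonRoot-covering F (+-monoʳ-≤ s 2p≤k)
    (factor-restrict T F.periodic 1≤p F.start≤lo F.hi≤1+end 2p≤k)
    (factor-widen F.start≤lo F.hi≤1+end)

  lyndonRoot-F' : LyndonRoot _≺_ (frag T F'.start F'.end) L
  lyndonRoot-F' = lyndonRoot-covering F' (+-monoʳ-≤ (s + k) 2p≤k)
    (λ f → factor-transport T (sameWindow-sym (at T) halves-agree) (factor-restrict T F'.periodic 1≤p F'.start≤lo F'.hi≤1+end 2p≤k f))
    (λ f → factor-widen F'.start≤lo F'.hi≤1+end (factor-transport T halves-agree f))

  private
    squareEnd≤ : ∀ {e} → s + (k + k) ≤ suc e → s + 2 * k ∸ 1 ≤ e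
    squareEnd≤ {e} h = ≤suc⇒pred-≤ (s + 2 * k) (subst (λ n → s + n ≤ suc e) (sym 2k≡k+k) h)

  c' d' : ℕ
  c' = R.start ⊔ (F.start ⊓ F'.start)
  d' = R.end ⊓ (F.end ⊔ F'.end)

  c'≤s : c' ≤ s
  c'≤s = ⊔-lub R.start≤lo (≤-trans (m⊓n≤m F.start F'.start) F.start≤lo)

  squareEnd≤d' : s + 2 * k ∸ 1 ≤ d'
  squareEnd≤d' = ⊓-glb (squareEnd≤ R.hi≤1+end)
                   (≤-trans (squareEnd≤ (subst (_≤ suc F'.end) (+-assoc s k k) F'.hi≤1+end)) (m≤n⊔m F.end F'.end))

  s+2k≤1+d' : s + (k + k) ≤ suc d'
  s+2k≤1+d' = subst (λ n → s + n ≤ suc d') 2k≡k+k (pred-≤⇒≤suc (s + 2 * k) squareEnd≤d')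

  c'≤d' : c' ≤ d'
  c'≤d' = ≤-trans c'≤s (≤-trans (∸-monoˡ-≤ 1 (m<m+n s (≤-trans 1≤k (m≤m+n k (k + 0))))) squareEnd≤d')

  d'<length : d' < length T
  d'<length = ≤-<-trans (m⊓n≤m R.end _) R.end<length

  PerIntersection : Per (frag T c' d') k
  PerIntersection = Equivalence.from (per-frag⇔ T c'≤d' d'<length)
           (minPeriodIn-extend MUU c'≤s s+2k≤1+d' (periodOn-restrict (at T) R.periodic (m≤m⊔n _ _) (s≤s (m⊓n≤m _ _))))

  squareIn-layer : InFragSquares T s k R.start R.end
  squareIn-layer = square , R.start≤lo , squareEnd≤ R.hi≤1+end , k , PerUU , R.per

  subperiod : SubPer T R.start R.end p
  subperiod = (s , k , squareIn-layer , PerU) ,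
              layer-subperiod-minimal T s k square MU 4p≤k R.start≤lo R.hi≤1+end R.periodic R.per

  layer : IsLayer T p F.start F.end F'.start F'.end R.start R.end
  layer = R.isRun , (p , k , subperiod , R.per , 4p≤k) , subperiod ,
          periodic-frag T c'≤d' d'<length PerIntersection (≤-trans (+-monoˡ-≤ (k + k) c'≤s) s+2k≤1+d') ,
          k , R.per , PerIntersection

  squareIn-intersection : InFragSquares T s k c' d'
  squareIn-intersection = square , c'≤s , squareEnd≤d' , k , PerUU , PerIntersection

  witness : PyramidSquare _≺_ T s k
  witness = F.start , F.end , F'.start , F'.end , p , L , R.start , R.end ,
            F.isRun , F'.isRun , neighboring , F.per , F'.per , lyndonRoot-F , lyndonRoot-F' ,
            layer , squareIn-intersection , PerU

lemma37 : {A : Set} (_≺_ : Rel A 0ℓ) → IsStrictTotalOrder _≡_ _≺_ →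
          (T : List A) (s k : ℕ) → IsSquareAt T s k →
          SpecialSquare (frag T s (s + k ∸ 1))
          ⇔
          (∃[ a ] ∃[ b ] ∃[ a' ] ∃[ b' ] ∃[ p ] ∃[ L ] ∃[ c ] ∃[ d ]
            (IsRun T a b × IsRun T a' b' × Neighboring a b a' b' ×
             Per (frag T a b) p × Per (frag T a' b') p ×
             LyndonRoot _≺_ (frag T a b) L × LyndonRoot _≺_ (frag T a' b') L ×
             IsLayer T p a b a' b' c d ×
             InFragSquares T s k (c ⊔ (a ⊓ a')) (d ⊓ (b ⊔ b')) ×
             Per (frag T s (s + k ∸ 1)) p))
lemma37 _≺_ sto T s k square = mk⇔ special⇒pyramid (pyramid⇒special T s k square)
  where
    special⇒pyramid : SpecialSquare (frag T s (s + k ∸ 1)) → PyramidSquare _≺_ T s k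
    special⇒pyramid (U-primitive , p , PerU , 4p≤|U|) =
      Pyramid.witness _≺_ sto T s k square U-primitive PerU (subst (4 * p ≤_) (SquareIn.length-root T s k square) 4p≤|U|)
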